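{- Let $G$ be a maximal planar graph with a fixed crossing-free embedding in the plane, and let $S \subseteq V(G)$ be such that every b-vertex of $G$ and every vertex of every facial octahedron of $G$ belongs to $M_G(S)$, and such that $|M_G(S \cup \{v\})| \leq |M_G(S)| + 3$ for every vertex $v \in V(G)$. Then every connected component of the subgraph of $G$ induced by $V(G) \setminus M_G(S)$ has at most three vertices.
   Context: For $S \subseteq V(G)$, $M_G(S)$ is defined as follows: initially $M_G(S) = N[S]$ ($S$ together with all neighbors of vertices of $S$); then, iteratively, a vertex $u$ is added to $M_G(S)$ whenever $u$ has a neighbor $v \in M_G(S)$ such that $u$ is the only neighbor of $v$ not in $M_G(S)$, until no more vertices can be added. A 3-vertex is a vertex of degree exactly 3; a b-vertex is a vertex $u$ with exactly two neighbors $y,y'$ of degree 3 such that $N[u] = N[y] \cup N[y']$. A subgraph $H$ of the embedded graph $G$ (with inherited embedding) is facial if every face of $H$ other than its unbounded face is a face of $G$; a facial octahedron is a facial subgraph isomorphic to the octahedron $K_{2,2,2}$. -}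

module Defs where

open import Data.Nat using (ℕ; zero; suc; _+_; _*_; _≤_; _≡ᵇ_; _≤ᵇ_; _/_)
open import Data.Fin using (Fin; toℕ)
open import Data.Bool using (Bool; true; false; _∧_; _∨_; not; if_then_else_)
open import Data.List using (List; allFin; upTo; foldr)
open import Data.Bool.ListAction using (any; all)
open import Data.Product using (Σ; ∃; _×_; _,_; proj₁; proj₂)
open import Data.Sum using (_⊎_)
open import Relation.Binary.PropositionalEquality using (_≡_; _≢_)
open import Relation.Nullary using (¬_)

iter : {A : Set} → ℕ → (A → A) → A → A
iter zero    f x = x
iter (suc k) f x = f (iter k f x)

Adj : ℕ → Set
Adj n = Fin n → Fin n → Bool

VSet : ℕ → Set
VSet n = Fin n → Bool

module _ {n : ℕ} where

  _=ᵛ_ : Fin n → Fin n → Bool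
  u =ᵛ v = toℕ u ≡ᵇ toℕ v

  anyV : (Fin n → Bool) → Bool
  anyV p = any p (allFin n)

  allV : (Fin n → Bool) → Bool
  allV p = all p (allFin n)

  countV : (Fin n → Bool) → ℕ
  countV p = foldr (λ i acc → (if p i then 1 else 0) + acc) 0 (allFin n)

  countPairs : (Fin n × Fin n → Bool) → ℕ
  countPairs p = foldr (λ u acc → countV (λ v → p (u , v)) + acc) 0 (allFin n)

record IsSimpleGraph {n : ℕ} (adj : Adj n) : Set where
  field
    symmetric   : ∀ u v → adj u v ≡ adj v u
    irreflexive : ∀ v → adj v v ≡ false

module _ {n : ℕ} (adj : Adj n) where

  degree : Fin n → ℕ
  degree v = countV (adj v)

  closedN : Fin n → VSet n
  closedN v x = (x =ᵛ v) ∨ adj v x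

  closedNS : VSet n → VSet n
  closedNS S x = S x ∨ anyV (λ s → S s ∧ adj s x)

  propagate : VSet n → VSet n
  propagate M u = M u ∨ anyV (λ v → M v ∧ adj v u ∧
                     allV (λ w → not (adj v w) ∨ (w =ᵛ u) ∨ M w))

  -- M_G(S): start with N[S], propagate until stable (n rounds suffice,
  -- since each non-stable round adds at least one vertex)
  MG : VSet n → VSet n
  MG S = iter n propagate (closedNS S)

  cardM : VSet n → ℕ
  cardM S = countV (MG S)

  insertV : VSet n → Fin n → VSet n
  insertV S v x = S x ∨ (x =ᵛ v)

  IsBVertex : Fin n → Set
  IsBVertex u = Σ (Fin n) λ y → Σ (Fin n) λ y' →
      (y ≢ y') × (adj u y ≡ true) × (adj u y' ≡ true) ×
      (degree y ≡ 3) × (degree y' ≡ 3) ×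
      (∀ z → adj u z ≡ true → degree z ≡ 3 → (z ≡ y) ⊎ (z ≡ y')) ×
      (∀ x → closedN u x ≡ (closedN y x ∨ closedN y' x))

  record Rotation : Set where
    field
      rot     : Fin n → Fin n → Fin n   -- rot v u = successor of u in cyclic order around v
      rot-adj : ∀ v u → adj v u ≡ true → adj v (rot v u) ≡ true
      rot-inj : ∀ v u w → adj v u ≡ true → adj v w ≡ true → rot v u ≡ rot v w → u ≡ w
      rot-cyc : ∀ v u w → adj v u ≡ true → adj v w ≡ true → ∃ λ k → iter k (rot v) u ≡ w

  Dart : Set
  Dart = Fin n × Fin n

  isDart : Dart → Bool
  isDart (u , v) = adj u v

  dartCode : Dart → ℕ
  dartCode (u , v) = toℕ u * n + toℕ v

  faceStep : (Fin n → Fin n → Fin n) → Dart → Dart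
  faceStep r (u , v) = (v , r v u)

  -- d is the dart of least code in its face orbit (face representative);
  -- orbits have length ≤ number of darts ≤ n*n
  isFaceRep : (Fin n → Fin n → Fin n) → Dart → Bool
  isFaceRep r d = isDart d ∧ all (λ k → dartCode d ≤ᵇ dartCode (iter k (faceStep r) d)) (upTo (n * n))

  numFaces : Rotation → ℕ
  numFaces ρ = countPairs (isFaceRep (Rotation.rot ρ))

  numDarts : ℕ
  numDarts = countPairs isDart

  numIsolated : ℕ
  numIsolated = countV (λ v → not (anyV (adj v)))

  reachᵇ : ℕ → Fin n → Fin n → Bool
  reachᵇ zero    u v = u =ᵛ v
  reachᵇ (suc k) u v = reachᵇ k u v ∨ anyV (λ w → reachᵇ k u w ∧ adj w v)

  numComponents : ℕ
  numComponents = countV (λ v → allV (λ u → not (reachᵇ n v u) ∨ (toℕ v ≤ᵇ toℕ u)))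

  -- Euler's formula summed over components, V - E + F + (#isolated) = 2c,
  -- characterising rotation systems of genus 0 on every component
  -- (written as 2V + 2F + 2·iso = D + 4c with D = 2E darts)
  IsPlaneRotation : Rotation → Set
  IsPlaneRotation ρ = 2 * n + 2 * numFaces ρ + 2 * numIsolated ≡ numDarts + 4 * numComponents

  Planar : Set
  Planar = Σ Rotation IsPlaneRotation

addEdge : {n : ℕ} → Adj n → Fin n → Fin n → Adj n
addEdge adj u v x y = adj x y ∨ ((x =ᵛ u) ∧ (y =ᵛ v)) ∨ ((x =ᵛ v) ∧ (y =ᵛ u))

module _ {n : ℕ} (adj : Adj n) where

  MaximalPlanar : Set
  MaximalPlanar = Planar adj ×
    (∀ u v → u ≢ v → adj u v ≡ false → ¬ Planar (addEdge adj u v))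

-- octahedron K_{2,2,2} on Fin 6: antipodal pairs {0,1},{2,3},{4,5};
-- i ~ j iff i ≠ j and they are not antipodal
octAdj : Fin 6 → Fin 6 → Bool
octAdj i j = not ((toℕ i ≡ᵇ toℕ j) ∨ ((toℕ i / 2) ≡ᵇ (toℕ j / 2)))

module _ {n : ℕ} (adj : Adj n) (ρ : Rotation adj) (outer : Dart adj) where
  open Rotation ρ

  -- first H-neighbour after u around v in G's cyclic order (H = given adjacency adjH)
  findNext : ℕ → (Fin n → Bool) → (Fin n → Fin n) → Fin n → Fin n
  findNext zero    P r x = r x
  findNext (suc k) P r x = if P (r x) then r x else findNext k P r (r x)

  octSub : (Fin 6 → Fin n) → Adj n
  octSub f x y = any (λ i → any (λ j → octAdj i j ∧ (f i =ᵛ x) ∧ (f j =ᵛ y)) (allFin 6)) (allFin 6)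

  inheritedRot : Adj n → Fin n → Fin n → Fin n
  inheritedRot adjH v u = findNext n (adjH v) (rot v) u

  SameFaceG : Dart adj → Dart adj → Set
  SameFaceG d d' = ∃ λ k → iter k (faceStep adj rot) d ≡ d'

  SameFaceH : Adj n → Dart adj → Dart adj → Set
  SameFaceH adjH d d' = ∃ λ k → iter k (faceStep adjH (inheritedRot adjH)) d ≡ d'

  HFaceIsGFace : Adj n → Dart adj → Set
  HFaceIsGFace adjH d = ∀ d' → (SameFaceH adjH d d' → SameFaceG d d') × (SameFaceG d d' → SameFaceH adjH d d')

  -- H is facial: every face of H other than its unbounded face is a face of G.
  -- The unbounded face F0 of H is the face of H containing the outer face f0 of G:
  -- if f0 is itself a face of H then F0 = f0.
  IsFacial : Adj n → Set
  IsFacial adjH = Σ (Dart adj) λ e0 → (isDart adjH e0 ≡ true) ×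
      (∀ d → isDart adjH d ≡ true → ¬ SameFaceH adjH e0 d → HFaceIsGFace adjH d) ×
      ((isDart adjH outer ≡ true) × HFaceIsGFace adjH outer → SameFaceH adjH e0 outer)

  IsFacialOctahedron : (Fin 6 → Fin n) → Set
  IsFacialOctahedron f = (∀ i j → f i ≡ f j → i ≡ j) ×
      (∀ i j → octAdj i j ≡ true → adj (f i) (f j) ≡ true) ×
      IsFacial (octSub f)

data WalkIn {n : ℕ} (adj : Adj n) (P : VSet n) : Fin n → Fin n → Set where
  nil  : ∀ {u} → P u ≡ true → WalkIn adj P u u
  cons : ∀ {u w v} → P u ≡ true → adj u w ≡ true → WalkIn adj P w v → WalkIn adj P u v

-- Adding a vertex v to S marks N[v] together with everything the propagation
-- rule then forces, so by hypothesis at most three unmarked vertices become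
-- marked.  Hence an unmarked vertex has at most two unmarked neighbours, and
-- there is no path a b c d on four unmarked vertices: adding b marks a, b, c,
-- after which all neighbours of c except d are marked, so c forces d.  In a
-- graph of maximum degree two without paths on four vertices every component
-- has at most three vertices.
module Submission where

open import Defs
open import Data.Nat using (ℕ; _+_; _≤_)
open import Data.Fin using (Fin)
open import Data.Bool using (Bool; true; false; not)
open import Data.Product using (Σ; _×_)
open import Data.Empty using (⊥)
open import Relation.Binary.PropositionalEquality using (_≡_)

open import Data.Nat using (zero; suc; _<_; z≤n; s≤s)
open import Data.Nat.Properties
  using (≤-refl; ≤-trans; ≤-<-trans; <⇒≤; <-irrefl; m≤n⇒m≤1+n; +-suc; +-identityʳ; +-monoˡ-≤; +-cancelˡ-≤; ≡ᵇ⇒≡; ≡⇒≡ᵇ; module ≤-Reasoning)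
open import Data.Fin using (toℕ; _≟_)
open import Data.Fin.Properties using (toℕ-injective; pigeonhole; <⇒≢) renaming (any? to anyFin?)
open import Data.Bool using (_∧_; _∨_; if_then_else_) renaming (_≟_ to _≟ᵇ_)
open import Data.Bool.Properties using (T-≡; not-injective)
open import Data.Bool.ListAction using (any; all)
open import Data.List using (List; []; _∷_; foldr; allFin; length; lookup)
open import Data.List.Properties using (length-tabulate)
open import Data.List.Relation.Unary.All using (All; []; _∷_; zipWith) renaming (map to All-map)
open import Data.List.Relation.Unary.AllPairs using (AllPairs; []; _∷_)
open import Data.List.Relation.Unary.Any using (here; there; index)
open import Data.List.Relation.Unary.Any.Properties using (lookup-index)
open import Data.List.Membership.Propositional using (_∈_)
open import Data.List.Membership.Propositional.Properties using (∈-allFin)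
open import Data.Product using (_,_)
open import Data.Sum using (_⊎_; inj₁; inj₂)
open import Data.Empty using (⊥-elim)
open import Function.Bundles using (Equivalence)
open import Relation.Nullary using (¬_; yes; no)
open import Relation.Nullary.Decidable using (_×-dec_; ¬?)
open import Relation.Binary.PropositionalEquality using (refl; sym; trans; cong; _≢_; ≢-sym; subst)

∨-introˡ : ∀ {a} b → a ≡ true → a ∨ b ≡ true
∨-introˡ b refl = refl

∨-introʳ : ∀ a {b} → b ≡ true → a ∨ b ≡ true
∨-introʳ true  _ = refl
∨-introʳ false e = e

∨-elim : ∀ {a b} → a ∨ b ≡ true → a ≡ true ⊎ b ≡ true
∨-elim {true}  _ = inj₁ refl
∨-elim {false} e = inj₂ e

∨-false : ∀ {a b} → a ≡ false → b ≡ false → a ∨ b ≡ false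
∨-false refl refl = refl

∧-intro : ∀ {a b} → a ≡ true → b ≡ true → a ∧ b ≡ true
∧-intro refl refl = refl

∨-mono : ∀ {a b c d} → (a ≡ true → c ≡ true) → (b ≡ true → d ≡ true) → a ∨ b ≡ true → c ∨ d ≡ true
∨-mono {true}  f g e = ∨-introˡ _ (f refl)
∨-mono {false} {c = c} f g e = ∨-introʳ c (g e)

∧-mono : ∀ {a b c d} → (a ≡ true → c ≡ true) → (b ≡ true → d ≡ true) → a ∧ b ≡ true → c ∧ d ≡ true
∧-mono {true} {true} f g _ = ∧-intro (f refl) (g refl)

module _ {A : Set} where

  any-intro : ∀ (p : A → Bool) {xs x} → x ∈ xs → p x ≡ true → any p xs ≡ true
  any-intro p {y ∷ xs} (here refl) e = ∨-introˡ (any p xs) e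
  any-intro p {y ∷ xs} (there x∈xs) e = ∨-introʳ (p y) (any-intro p x∈xs e)

  all-intro : ∀ (p : A → Bool) xs → (∀ x → p x ≡ true) → all p xs ≡ true
  all-intro p []       _ = refl
  all-intro p (y ∷ xs) f = ∧-intro (f y) (all-intro p xs f)

  any-mono : ∀ {p q : A → Bool} xs → (∀ x → p x ≡ true → q x ≡ true) → any p xs ≡ true → any q xs ≡ true
  any-mono []       f ()
  any-mono (y ∷ xs) f = ∨-mono (f y) (any-mono xs f)

  all-mono : ∀ {p q : A → Bool} xs → (∀ x → p x ≡ true → q x ≡ true) → all p xs ≡ true → all q xs ≡ true
  all-mono []       f _ = refl
  all-mono (y ∷ xs) f = ∧-mono (f y) (all-mono xs f)

  ∈-pigeonhole : ∀ {m} (xs : List A) → length xs < m → (a : Fin m → A) →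
    (∀ i j → a i ≡ a j → i ≡ j) → ¬ (∀ i → a i ∈ xs)
  ∈-pigeonhole xs short a a-injective a∈xs with pigeonhole short (λ i → index (a∈xs i))
  ... | i , j , i<j , same-index = <⇒≢ i<j (a-injective i j
        (trans (lookup-index (a∈xs i)) (trans (cong (lookup xs) same-index) (sym (lookup-index (a∈xs j))))))

  count : (A → Bool) → List A → ℕ
  count p = foldr (λ x acc → (if p x then 1 else 0) + acc) 0

  count-≤-length : ∀ p xs → count p xs ≤ length xs
  count-≤-length p []       = z≤n
  count-≤-length p (y ∷ xs) with p y
  ... | true  = s≤s (count-≤-length p xs)
  ... | false = m≤n⇒m≤1+n (count-≤-length p xs)

  count-mono : ∀ {p q : A → Bool} xs → (∀ x → p x ≡ true → q x ≡ true) → count p xs ≤ count q xs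
  count-mono []                   f = z≤n
  count-mono {p} {q} (y ∷ xs) f with p y in py | q y in qy
  ... | true  | true  = s≤s (count-mono xs f)
  ... | false | true  = m≤n⇒m≤1+n (count-mono xs f)
  ... | false | false = count-mono xs f
  ... | true  | false with () ← trans (sym qy) (f y py)

  count-< : ∀ {p q : A → Bool} {xs x} → (∀ x → p x ≡ true → q x ≡ true) →
            x ∈ xs → p x ≡ false → q x ≡ true → count p xs < count q xs
  count-< {xs = _ ∷ xs} f (here refl) px qx rewrite px | qx = s≤s (count-mono xs f)
  count-< {p} {q} {y ∷ _} f (there x∈xs) px qx with p y in py | q y in qy
  ... | true  | true  = s≤s (count-< f x∈xs px qx)
  ... | false | true  = s≤s (<⇒≤ (count-< f x∈xs px qx))
  ... | false | false = count-< f x∈xs px qx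
  ... | true  | false with () ← trans (sym qy) (f y py)

module _ {n : ℕ} where

  =ᵛ-refl : (x : Fin n) → x =ᵛ x ≡ true
  =ᵛ-refl x = Equivalence.to T-≡ (≡⇒≡ᵇ (toℕ x) (toℕ x) refl)

  =ᵛ-sound : ∀ {x y : Fin n} → x =ᵛ y ≡ true → x ≡ y
  =ᵛ-sound {x} {y} e = toℕ-injective (≡ᵇ⇒≡ (toℕ x) (toℕ y) (Equivalence.from T-≡ e))

  =ᵛ-false : ∀ {x y : Fin n} → x ≢ y → x =ᵛ y ≡ false
  =ᵛ-false {x} {y} x≢y with x =ᵛ y in e
  ... | true  = ⊥-elim (x≢y (=ᵛ-sound e))
  ... | false = refl

  infix 4 _⊆_
  _⊆_ : VSet n → VSet n → Set
  A ⊆ B = ∀ x → A x ≡ true → B x ≡ true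

  countV-≤ : ∀ A → countV A ≤ n
  countV-≤ A = subst (countV A ≤_) (length-tabulate (λ i → i)) (count-≤-length A (allFin n))

  countV-mono : ∀ {A B} → A ⊆ B → countV A ≤ countV B
  countV-mono = count-mono (allFin n)

  countV-< : ∀ {A B x} → A ⊆ B → A x ≡ false → B x ≡ true → countV A < countV B
  countV-< {x = x} A⊆B = count-< A⊆B (∈-allFin x)

  countV-+-length : ∀ {A B ps} → A ⊆ B → AllPairs _≢_ ps →
    All (λ p → A p ≡ false) ps → All (λ p → B p ≡ true) ps → countV A + length ps ≤ countV B
  countV-+-length {A} {B} {[]} A⊆B _ _ _ = begin
    countV A + 0  ≡⟨ +-identityʳ (countV A) ⟩
    countV A      ≤⟨ countV-mono A⊆B ⟩
    countV B      ∎
    where open ≤-Reasoning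
  countV-+-length {A} {B} {p ∷ ps} A⊆B (p≢ps ∷ distinct) (Ap ∷ Aps) (Bp ∷ Bps) = begin
    countV A + suc (length ps)  ≡⟨ +-suc (countV A) (length ps) ⟩
    suc (countV A) + length ps  ≤⟨ +-monoˡ-≤ (length ps) (countV-< A⊆A′ Ap (∨-introʳ (A p) (=ᵛ-refl p))) ⟩
    countV A′ + length ps       ≤⟨ countV-+-length A′⊆B distinct A′-avoids Bps ⟩
    countV B                    ∎
    where
    open ≤-Reasoning

    A′ : VSet n
    A′ x = A x ∨ (x =ᵛ p)

    A⊆A′ : A ⊆ A′
    A⊆A′ x e = ∨-introˡ _ e

    A′⊆B : A′ ⊆ B
    A′⊆B x e with ∨-elim {A x} e
    ... | inj₁ Ax = A⊆B x Ax
    ... | inj₂ x≡p = subst (λ y → B y ≡ true) (sym (=ᵛ-sound x≡p)) Bp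

    A′-avoids : All (λ q → A′ q ≡ false) ps
    A′-avoids = zipWith (λ { (Aq , p≢q) → ∨-false Aq (=ᵛ-false (≢-sym p≢q)) }) (Aps , p≢ps)

module Saturation {n : ℕ} (f : VSet n → VSet n)
  (f-mono : ∀ {A B} → A ⊆ B → f A ⊆ f B) (f-inflationary : ∀ A → A ⊆ f A) where

  iter-mono : ∀ {A B} → A ⊆ B → ∀ k → iter k f A ⊆ iter k f B
  iter-mono A⊆B zero    = A⊆B
  iter-mono A⊆B (suc k) = f-mono (iter-mono A⊆B k)

  iter-inflationary : ∀ A k → A ⊆ iter k f A
  iter-inflationary A zero    x e = e
  iter-inflationary A (suc k) x e = f-inflationary (iter k f A) x (iter-inflationary A k x e)

  stable-or-grows : ∀ A → f A ⊆ A ⊎ countV A < countV (f A)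
  stable-or-grows A with anyFin? (λ x → (f A x ≟ᵇ true) ×-dec (A x ≟ᵇ false))
  ... | yes (x , fAx , Ax) = inj₂ (countV-< (f-inflationary A) Ax fAx)
  ... | no ∄x = inj₁ stable
    where
    stable : f A ⊆ A
    stable x fAx with A x in Ax
    ... | true  = refl
    ... | false = ⊥-elim (∄x (x , fAx , Ax))

  stable-or-large : ∀ A k → f (iter k f A) ⊆ iter k f A ⊎ k < countV (iter (suc k) f A)
  stable-or-large A zero with stable-or-grows A
  ... | inj₁ stable = inj₁ stable
  ... | inj₂ grows  = inj₂ (≤-<-trans z≤n grows)
  stable-or-large A (suc k) with stable-or-large A k
  ... | inj₁ stable = inj₁ (f-mono stable)
  ... | inj₂ large with stable-or-grows (iter (suc k) f A)
  ... | inj₁ stable = inj₁ stable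
  ... | inj₂ grows  = inj₂ (≤-<-trans large grows)

  iter-closed : ∀ A → f (iter n f A) ⊆ iter n f A
  iter-closed A with stable-or-large A n
  ... | inj₁ stable = stable
  ... | inj₂ large  = ⊥-elim (<-irrefl refl (≤-<-trans (countV-≤ _) large))

module _ {n : ℕ} (adj : Adj n) where

  propagate-mono : ∀ {A B} → A ⊆ B → propagate adj A ⊆ propagate adj B
  propagate-mono A⊆B u = ∨-mono (A⊆B u)
    (any-mono (allFin n) λ v → ∧-mono (A⊆B v) (∧-mono {adj v u} (λ e → e)
      (all-mono (allFin n) λ w → ∨-mono {not (adj v w)} (λ e → e) (∨-mono {w =ᵛ u} (λ e → e) (A⊆B w)))))

  propagate-inflationary : ∀ A → A ⊆ propagate adj A
  propagate-inflationary A u = ∨-introˡ _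

  open Saturation (propagate adj) propagate-mono propagate-inflationary

  closedNS-mono : ∀ {S T} → S ⊆ T → closedNS adj S ⊆ closedNS adj T
  closedNS-mono S⊆T x = ∨-mono (S⊆T x)
    (any-mono (allFin n) λ s → ∧-mono {b = adj s x} (S⊆T s) (λ e → e))

  MG-mono : ∀ {S T} → S ⊆ T → MG adj S ⊆ MG adj T
  MG-mono S⊆T = iter-mono (closedNS-mono S⊆T) n

  closedNS⊆MG : ∀ S → closedNS adj S ⊆ MG adj S
  closedNS⊆MG S = iter-inflationary (closedNS adj S) n

  MG-closed : ∀ S → propagate adj (MG adj S) ⊆ MG adj S
  MG-closed S = iter-closed (closedNS adj S)

  MG⊆MG-insertV : ∀ S v → MG adj S ⊆ MG adj (insertV adj S v)
  MG⊆MG-insertV S v = MG-mono (λ x → ∨-introˡ _)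

  closedN⊆MG-insertV : ∀ S v → closedN adj v ⊆ MG adj (insertV adj S v)
  closedN⊆MG-insertV S v x e = closedNS⊆MG (insertV adj S v) x (N[v]⊆N[S∪v] (∨-elim {x =ᵛ v} e))
    where
    v∈S∪v : insertV adj S v v ≡ true
    v∈S∪v = ∨-introʳ (S v) (=ᵛ-refl v)

    N[v]⊆N[S∪v] : x =ᵛ v ≡ true ⊎ adj v x ≡ true → closedNS adj (insertV adj S v) x ≡ true
    N[v]⊆N[S∪v] (inj₁ x≡v) = ∨-introˡ _ (subst (λ y → insertV adj S v y ≡ true) (sym (=ᵛ-sound x≡v)) v∈S∪v)
    N[v]⊆N[S∪v] (inj₂ v~x) = ∨-introʳ _ (any-intro _ (∈-allFin v) (∧-intro v∈S∪v v~x))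

  propagate-forces : ∀ {X c d} → X c ≡ true → adj c d ≡ true →
    (∀ w → adj c w ≡ true → w ≢ d → X w ≡ true) → propagate adj X d ≡ true
  propagate-forces {X} {c} {d} Xc c~d others =
    ∨-introʳ (X d) (any-intro _ (∈-allFin c) (∧-intro Xc (∧-intro c~d (all-intro _ (allFin n) allowed))))
    where
    allowed : ∀ w → not (adj c w) ∨ (w =ᵛ d) ∨ X w ≡ true
    allowed w with adj c w in c~w | w ≟ d
    ... | false | _         = refl
    ... | true  | yes refl  = ∨-introˡ _ (=ᵛ-refl w)
    ... | true  | no  w≢d   = ∨-introʳ (w =ᵛ d) (others w c~w w≢d)

module _ {n : ℕ} {adj : Adj n} (simple : IsSimpleGraph adj) where
  open IsSimpleGraph simple

  adj-sym : ∀ {x y} → adj x y ≡ true → adj y x ≡ true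
  adj-sym {x} {y} x~y = trans (symmetric y x) x~y

  adj⇒≢ : ∀ {x y} → adj x y ≡ true → x ≢ y
  adj⇒≢ {x} x~x refl with () ← trans (sym x~x) (irreflexive x)

module _ {n : ℕ} (adj : Adj n) (R : VSet n) where

  MaxDegree≤2 : Set
  MaxDegree≤2 = ∀ {v x y z} → R v ≡ true → R x ≡ true → R y ≡ true → R z ≡ true →
    adj v x ≡ true → adj v y ≡ true → adj v z ≡ true → x ≢ y → x ≢ z → y ≢ z → ⊥

  Path4-free : Set
  Path4-free = ∀ {a b c d} → R a ≡ true → R b ≡ true → R c ≡ true → R d ≡ true →
    adj a b ≡ true → adj b c ≡ true → adj c d ≡ true → a ≢ c → a ≢ d → b ≢ d → ⊥

  NeighbourClosed : List (Fin n) → Set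
  NeighbourClosed K = ∀ {x y} → x ∈ K → R y ≡ true → adj x y ≡ true → y ∈ K

  walk-start : ∀ {u v} → WalkIn adj R u v → R u ≡ true
  walk-start (nil Ru)      = Ru
  walk-start (cons Ru _ _) = Ru

  walk-stays : ∀ {K u v} → NeighbourClosed K → u ∈ K → WalkIn adj R u v → v ∈ K
  walk-stays closed u∈K (nil _)         = u∈K
  walk-stays closed u∈K (cons _ u~w wk) = walk-stays closed (closed u∈K (walk-start wk) u~w) wk

module SmallComponents {n : ℕ} {adj : Adj n} (simple : IsSimpleGraph adj) (R : VSet n)
  (max-degree≤2 : MaxDegree≤2 adj R) (path4-free : Path4-free adj R) where

  path3-closed : ∀ {x m y} → R x ≡ true → R m ≡ true → R y ≡ true →
    adj m x ≡ true → adj m y ≡ true → x ≢ y → NeighbourClosed adj R (x ∷ m ∷ y ∷ [])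
  path3-closed {x} {m} {y} Rx Rm Ry m~x m~y x≢y = closed
    where
    from-middle : ∀ {w} → R w ≡ true → adj m w ≡ true → w ∈ (x ∷ m ∷ y ∷ [])
    from-middle {w} Rw m~w with w ≟ x | w ≟ y
    ... | yes refl | _        = here refl
    ... | no _     | yes refl = there (there (here refl))
    ... | no w≢x   | no w≢y   = ⊥-elim (max-degree≤2 Rm Rx Ry Rw m~x m~y m~w x≢y (≢-sym w≢x) (≢-sym w≢y))

    from-end : ∀ {e e′ w} → R e ≡ true → R e′ ≡ true → adj m e ≡ true → adj m e′ ≡ true → e ≢ e′ →
      R w ≡ true → adj e w ≡ true → w ≡ m ⊎ w ≡ e′
    from-end {e} {e′} {w} Re Re′ m~e m~e′ e≢e′ Rw e~w with w ≟ m | w ≟ e′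
    ... | yes w≡m | _        = inj₁ w≡m
    ... | no _    | yes w≡e′ = inj₂ w≡e′
    ... | no w≢m  | no w≢e′  =
      ⊥-elim (path4-free Rw Re Rm Re′ (adj-sym simple e~w) (adj-sym simple m~e) m~e′ w≢m w≢e′ e≢e′)

    closed : NeighbourClosed adj R (x ∷ m ∷ y ∷ [])
    closed (here refl) Rw x~w with from-end Rx Ry m~x m~y x≢y Rw x~w
    ... | inj₁ refl = there (here refl)
    ... | inj₂ refl = there (there (here refl))
    closed (there (here refl)) Rw m~w = from-middle Rw m~w
    closed (there (there (here refl))) Rw y~w with from-end Ry Rx m~y m~x (≢-sym x≢y) Rw y~w
    ... | inj₁ refl = there (here refl)
    ... | inj₂ refl = here refl

  small-closed-neighbourhood : ∀ {u} → R u ≡ true →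
    Σ (List (Fin n)) λ K → length K ≤ 3 × u ∈ K × NeighbourClosed adj R K
  small-closed-neighbourhood {u} Ru
    with anyFin? (λ x → (R x ≟ᵇ true) ×-dec (adj u x ≟ᵇ true))
  ... | no ∄x = u ∷ [] , s≤s z≤n , here refl , closed
    where
    closed : NeighbourClosed adj R (u ∷ [])
    closed (here refl) Rw u~w = ⊥-elim (∄x (_ , Rw , u~w))
  ... | yes (x , Rx , u~x)
    with anyFin? (λ y → (R y ≟ᵇ true) ×-dec (adj u y ≟ᵇ true) ×-dec ¬? (y ≟ x))
  ... | yes (y , Ry , u~y , y≢x) =
    x ∷ u ∷ y ∷ [] , ≤-refl , there (here refl) , path3-closed Rx Ru Ry u~x u~y (≢-sym y≢x)
  ... | no only-x
    with anyFin? (λ z → (R z ≟ᵇ true) ×-dec (adj x z ≟ᵇ true) ×-dec ¬? (z ≟ u))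
  ... | yes (z , Rz , x~z , z≢u) =
    u ∷ x ∷ z ∷ [] , ≤-refl , here refl , path3-closed Ru Rx Rz (adj-sym simple u~x) x~z (≢-sym z≢u)
  ... | no only-u = u ∷ x ∷ [] , s≤s (s≤s z≤n) , here refl , closed
    where
    closed : NeighbourClosed adj R (u ∷ x ∷ [])
    closed {y = w} (here refl) Rw u~w with w ≟ x
    ... | yes refl = there (here refl)
    ... | no w≢x   = ⊥-elim (only-x (w , Rw , u~w , w≢x))
    closed {y = w} (there (here refl)) Rw x~w with w ≟ u
    ... | yes refl = here refl
    ... | no w≢u   = ⊥-elim (only-u (w , Rw , x~w , w≢u))

  no-four-reachable : ∀ {u} → R u ≡ true → (a : Fin 4 → Fin n) → (∀ i j → a i ≡ a j → i ≡ j) →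
    ¬ (∀ i → WalkIn adj R u (a i))
  no-four-reachable Ru a a-injective walks with small-closed-neighbourhood Ru
  ... | K , |K|≤3 , u∈K , closed =
    ∈-pigeonhole K (s≤s |K|≤3) a a-injective (λ i → walk-stays adj R closed u∈K (walks i))

Unmarked : {n : ℕ} → Adj n → VSet n → VSet n
Unmarked adj S x = not (MG adj S x)

module _ {n : ℕ} {adj : Adj n} (simple : IsSimpleGraph adj) (S : VSet n)
  (few-new : ∀ v → cardM adj (insertV adj S v) ≤ cardM adj S + 3) where

  at-most-three-newly-marked : ∀ v {ps} → AllPairs _≢_ ps → All (λ x → Unmarked adj S x ≡ true) ps →
    All (λ x → MG adj (insertV adj S v) x ≡ true) ps → length ps ≤ 3
  at-most-three-newly-marked v distinct unmarked marked = +-cancelˡ-≤ (cardM adj S) _ _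
    (≤-trans (countV-+-length (MG⊆MG-insertV adj S v) distinct (All-map not-injective unmarked) marked)
             (few-new v))

  unmarked-max-degree≤2 : MaxDegree≤2 adj (Unmarked adj S)
  unmarked-max-degree≤2 {v} {x} {y} {z} Rv Rx Ry Rz v~x v~y v~z x≢y x≢z y≢z =
    <-irrefl refl (at-most-three-newly-marked v distinct (Rv ∷ Rx ∷ Ry ∷ Rz ∷ [])
      (N[v] v (∨-introˡ _ (=ᵛ-refl v)) ∷ N[v] x (∨-introʳ _ v~x) ∷ N[v] y (∨-introʳ _ v~y) ∷ N[v] z (∨-introʳ _ v~z) ∷ []))
    where
    N[v] : closedN adj v ⊆ MG adj (insertV adj S v)
    N[v] = closedN⊆MG-insertV adj S v

    distinct : AllPairs _≢_ (v ∷ x ∷ y ∷ z ∷ [])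
    distinct = (adj⇒≢ simple v~x ∷ adj⇒≢ simple v~y ∷ adj⇒≢ simple v~z ∷ [])
             ∷ (x≢y ∷ x≢z ∷ []) ∷ (y≢z ∷ []) ∷ [] ∷ []

  unmarked-path4-free : Path4-free adj (Unmarked adj S)
  unmarked-path4-free {a} {b} {c} {d} Ra Rb Rc Rd a~b b~c c~d a≢c a≢d b≢d =
    <-irrefl refl (at-most-three-newly-marked b distinct (Ra ∷ Rb ∷ Rc ∷ Rd ∷ [])
      (N[b] a (∨-introʳ _ (adj-sym simple a~b)) ∷ b-marked ∷ N[b] c (∨-introʳ _ b~c) ∷ d-marked ∷ []))
    where
    N[b] : closedN adj b ⊆ MG adj (insertV adj S b)
    N[b] = closedN⊆MG-insertV adj S b

    b-marked : MG adj (insertV adj S b) b ≡ true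
    b-marked = N[b] b (∨-introˡ _ (=ᵛ-refl b))

    others-marked : ∀ w → adj c w ≡ true → w ≢ d → MG adj (insertV adj S b) w ≡ true
    others-marked w c~w w≢d with MG adj S w in Mw | w ≟ b
    ... | true  | _        = MG⊆MG-insertV adj S b w Mw
    ... | false | yes refl = b-marked
    ... | false | no w≢b   = ⊥-elim (unmarked-max-degree≤2 Rc Rb Rd (cong not Mw)
            (adj-sym simple b~c) c~d c~w b≢d (≢-sym w≢b) (≢-sym w≢d))

    d-marked : MG adj (insertV adj S b) d ≡ true
    d-marked = MG-closed adj (insertV adj S b) d
      (propagate-forces adj (N[b] c (∨-introʳ _ b~c)) c~d others-marked)

    distinct : AllPairs _≢_ (a ∷ b ∷ c ∷ d ∷ [])
    distinct = (adj⇒≢ simple a~b ∷ a≢c ∷ a≢d ∷ [])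
             ∷ (adj⇒≢ simple b~c ∷ b≢d ∷ []) ∷ (adj⇒≢ simple c~d ∷ []) ∷ [] ∷ []

lemma11 : (n : ℕ) (adj : Adj n) → IsSimpleGraph adj → MaximalPlanar adj →
    (ρ : Rotation adj) → IsPlaneRotation adj ρ →
    (outer : Dart adj) → isDart adj outer ≡ true →
    (S : VSet n) →
    (∀ u → IsBVertex adj u → MG adj S u ≡ true) →
    (∀ (f : Fin 6 → Fin n) → IsFacialOctahedron adj ρ outer f → ∀ i → MG adj S (f i) ≡ true) →
    (∀ v → cardM adj (insertV adj S v) ≤ cardM adj S + 3) →
    ∀ (u : Fin n) → MG adj S u ≡ false →
    (a : Fin 4 → Fin n) → (∀ i j → a i ≡ a j → i ≡ j) →
    (∀ i → WalkIn adj (λ x → not (MG adj S x)) u (a i)) → ⊥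
lemma11 n adj simple _ _ _ _ _ S _ _ few-new u u-unmarked =
  SmallComponents.no-four-reachable simple (Unmarked adj S)
    (unmarked-max-degree≤2 simple S few-new) (unmarked-path4-free simple S few-new) (cong not u-unmarked)
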